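{- Let $k\ge 2$ be an integer and $m=\lceil \log_2(1+k)\rceil$. Let $A_k$ be the graph with vertex set $\{u\}\cup\{v_1,\dots,v_k\}\cup\{w_0,\dots,w_{m-1}\}\cup\{w'_0,\dots,w'_{m-1}\}$ and edge set \[\{uv_1,\dots,uv_k\}\cup\{v_jw_i : 1\le j\le k,\ 0\le i\le m-1,\ \lfloor j/2^i\rfloor \bmod 2 = 0\}\cup\{w_0w'_0,\dots,w_{m-1}w'_{m-1}\}.\] Then $\Psi(L(A_k)) = m = \lceil \log_2(1+\Delta(A_k))\rceil$, where $\Delta(A_k)$ is the maximum degree of $A_k$.
   Context: For a connected graph $H$ with distance $d_H$, a pair $\{x,y\}$ of vertices doubly resolves a pair $\{u,v\}$ if $d_H(u,x)-d_H(u,y)\neq d_H(v,x)-d_H(v,y)$; a set $S\subseteq V(H)$ is a doubly resolving set if every pair of distinct vertices of $H$ is doubly resolved by some pair of vertices of $S$, and $\Psi(H)$ is the minimum size of such a set. $L(G)$ denotes the line graph of $G$ (vertices are the edges of $G$, adjacent iff they share an end vertex). -}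

module Defs where

open import Data.Nat using (ℕ; zero; suc; _≤_; _^_; _/_; _%_)
open import Data.Nat.Properties using (m^n≢0)
open import Data.Nat.Logarithm using (⌈log₂_⌉)
open import Data.Integer using (ℤ; +_; _-_)
open import Data.Fin using (Fin; toℕ)
open import Data.List using (List; length)
open import Data.List.Membership.Propositional using (_∈_)
open import Data.List.Relation.Unary.Unique.Propositional using (Unique)
open import Data.Product using (Σ; ∃; ∃-syntax; _×_; _,_; proj₁; proj₂)
open import Data.Sum using (_⊎_)
open import Relation.Binary.PropositionalEquality using (_≡_; _≢_)
open import Function.Bundles using (_⇔_)

module _ {V : Set} (_~_ : V → V → Set) where

  data Walk : V → V → ℕ → Set where
    nil  : ∀ x → Walk x x 0
    cons : ∀ {x y z n} → x ~ y → Walk y z n → Walk x z (suc n)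

  Dist : V → V → ℕ → Set
  Dist x y n = Walk x y n × (∀ n' → Walk x y n' → n ≤ n')

  Connected : Set
  Connected = ∀ x y → ∃[ n ] Walk x y n

  DoublyResolves : V → V → V → V → Set
  DoublyResolves x y a b =
    ∃[ dax ] ∃[ day ] ∃[ dbx ] ∃[ dby ]
      (Dist a x dax × Dist a y day × Dist b x dbx × Dist b y dby ×
       ((+ dax) - (+ day) ≢ (+ dbx) - (+ dby)))

  IsDoublyResolvingSet : List V → Set
  IsDoublyResolvingSet S =
    ∀ a b → a ≢ b → ∃[ x ] ∃[ y ] (x ∈ S × y ∈ S × DoublyResolves x y a b)

  PsiIs : ℕ → Set
  PsiIs n =
    (∃[ S ] (Unique S × length S ≡ n × IsDoublyResolvingSet S)) ×
    (∀ S → Unique S → IsDoublyResolvingSet S → n ≤ length S)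

module _ {V E : Set} (ends : E → V × V) where

  Incident : V → E → Set
  Incident x e = (x ≡ proj₁ (ends e)) ⊎ (x ≡ proj₂ (ends e))

  LineAdj : E → E → Set
  LineAdj e f = e ≢ f × ∃[ x ] (Incident x e × Incident x f)

  DegreeIs : V → ℕ → Set
  DegreeIs x d =
    ∃[ l ] (Unique l × (∀ e → (e ∈ l) ⇔ Incident x e) × length l ≡ d)

  MaxDegreeIs : ℕ → Set
  MaxDegreeIs d =
    (∃[ x ] DegreeIs x d) × (∀ x d' → DegreeIs x d' → d' ≤ d)

mA : ℕ → ℕ
mA k = ⌈log₂ (suc k) ⌉

-- Vertices: u, v_j (j = 1..k, with v (j : Fin k) standing for v_{toℕ j + 1}),
-- w_i and w'_i (i = 0..m-1).
data VA (k : ℕ) : Set where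
  u  : VA k
  v  : Fin k → VA k
  w  : Fin (mA k) → VA k
  w' : Fin (mA k) → VA k

BitZero : ∀ {k} → Fin k → Fin (mA k) → Set
BitZero jj ii =
  ((_/_ (suc (toℕ jj)) (2 ^ toℕ ii) {{m^n≢0 2 (toℕ ii)}}) % 2) ≡ 0

data EA (k : ℕ) : Set where
  uv  : Fin k → EA k
  vw  : (j : Fin k) (i : Fin (mA k)) → BitZero j i → EA k
  ww' : Fin (mA k) → EA k

endsA : ∀ {k} → EA k → VA k × VA k
endsA (uv j)     = u , v j
endsA (vw j i _) = v j , w i
endsA (ww' i)    = w i , w' i

LAk : ∀ k → EA k → EA k → Set
LAk k = LineAdj (endsA {k})

{-# OPTIONS --safe #-}
module Submission where

-- Distances in L(A_k) are computed from potentials: a function h on the edges with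
-- h t = 0, |h e - h f| ≤ 1 for adjacent e, f, and a neighbour one lower at every
-- e ≢ t, is the distance to t.  Seen from u v_j, an edge e is at distance
-- level e + offset j e, and offset j (w_i w′_i) is bit i of j.  So if S doubly
-- resolves every pair {u v_j, u v_j′}, the k binary vectors (offset j s)_{s ∈ S}
-- pairwise do not differ by a constant, whence k < 2^|S| and |S| ≥ m.  Conversely
-- the m edges w_i w′_i doubly resolve L(A_k): for a ≢ b there are i, i′ with a
-- strictly closer than b to w_i w′_i but not farther from w_i′ w′_i′.  Finally u
-- has degree k and labelling edges by bits or by vertices shows no degree exceeds k.

open import Defs
open import Data.Nat using (ℕ; zero; suc; pred; _≤ᵇ_; _≤_; _<_; _≤?_; _<?_; _+_; _*_; _∸_; _^_; _/_; _%_; ⌊_/2⌋; z≤n; s≤s; NonZero)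
open import Data.Nat.DivMod using (m%n<n; m≡m%n+[m/n]*n; n/1≡n; n/n≡1; m/n/o≡m/[n*o]; m<n*o⇒m/o<n; m<n⇒m/n≡0)
open import Data.Nat.Logarithm using (⌈log₂_⌉; ⌈log₂⌉-mono-≤; ⌈log₂2^n⌉≡n; ⌈log₂⌈n/2⌉⌉≡⌈log₂n⌉∸1)
import Data.Nat.Properties as ℕₚ
open import Algebra.Properties.CommutativeSemigroup ℕₚ.+-commutativeSemigroup using (interchange)
open import Data.Integer as ℤ using (ℤ; +_; _-_)
import Data.Integer.Properties as ℤₚ
open import Data.Integer.Tactic.RingSolver using (solve-∀)
open import Data.Fin using (Fin; zero; suc; toℕ; fromℕ<; inject≤; funToFin; finToFun)
import Data.Fin.Properties as Fin
open import Data.List using (List; length; lookup; map; allFin)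
import Data.List.Properties as LP
open import Data.List.Membership.Propositional using (_∈_)
open import Data.List.Membership.Propositional.Properties using (∈-lookup; ∈-map⁺; ∈-map⁻; ∈-allFin)
open import Data.List.Relation.Unary.Any using (index)
open import Data.List.Relation.Unary.Any.Properties using (lookup-index)
open import Data.List.Relation.Unary.AllPairs using (_∷_)
import Data.List.Relation.Unary.All as All
open import Data.List.Relation.Unary.Unique.Propositional using (Unique)
open import Data.List.Relation.Unary.Unique.Propositional.Properties using (map⁺; allFin⁺)
open import Data.Product using (∃; ∃-syntax; _×_; _,_; proj₁; proj₂)
open import Data.Sum using (_⊎_; inj₁; inj₂)
import Data.Sum as Sum
open import Data.Bool using (T)
open import Function using (_∘_; id)
open import Function.Bundles using (_⇔_; mk⇔; Equivalence)
open import Relation.Binary.PropositionalEquality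
  using (_≡_; _≢_; _≗_; refl; sym; trans; cong; cong₂; subst; subst₂; module ≡-Reasoning)
open import Relation.Nullary using (¬_; Dec; contradiction; yes; no; _×-dec_)

x-y≡z-t⇔x+t≡z+y : ∀ (x y z t : ℤ) → (x - y ≡ z - t) ⇔ (x ℤ.+ t ≡ z ℤ.+ y)
x-y≡z-t⇔x+t≡z+y x y z t = mk⇔ to from
  where
  open ≡-Reasoning
  shift : ∀ (x y t : ℤ) → x ℤ.+ t ≡ (x - y) ℤ.+ (y ℤ.+ t)
  shift = solve-∀
  cancel : ∀ (x y t : ℤ) → x - y ≡ (x ℤ.+ t) - (y ℤ.+ t)
  cancel = solve-∀
  to : x - y ≡ z - t → x ℤ.+ t ≡ z ℤ.+ y
  to eq = begin
    x ℤ.+ t               ≡⟨ shift x y t ⟩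
    (x - y) ℤ.+ (y ℤ.+ t) ≡⟨ cong₂ ℤ._+_ eq (ℤₚ.+-comm y t) ⟩
    (z - t) ℤ.+ (t ℤ.+ y) ≡⟨ sym (shift z t y) ⟩
    z ℤ.+ y               ∎
  from : x ℤ.+ t ≡ z ℤ.+ y → x - y ≡ z - t
  from eq = begin
    x - y                   ≡⟨ cancel x y t ⟩
    (x ℤ.+ t) - (y ℤ.+ t)   ≡⟨ cong₂ _-_ eq (ℤₚ.+-comm y t) ⟩
    (z ℤ.+ y) - (t ℤ.+ y)   ≡⟨ sym (cancel z t y) ⟩
    z - t                   ∎

+a-+b≡+c-+d⇔a+d≡c+b : ∀ a b c d → (+ a - + b ≡ + c - + d) ⇔ (a + d ≡ c + b)
+a-+b≡+c-+d⇔a+d≡c+b a b c d = mk⇔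
  (λ eq → ℤₚ.+-injective (trans (ℤₚ.pos-+ a d) (trans (Equivalence.to ints eq) (sym (ℤₚ.pos-+ c b)))))
  (λ eq → Equivalence.from ints (trans (sym (ℤₚ.pos-+ a d)) (trans (cong +_ eq) (ℤₚ.pos-+ c b))))
  where ints = x-y≡z-t⇔x+t≡z+y (+ a) (+ b) (+ c) (+ d)

≤1⇒≤suc : ∀ {a b} → a ≤ 1 → a ≤ suc b
≤1⇒≤suc a≤1 = ℕₚ.≤-trans a≤1 (s≤s z≤n)

≤-closed : ∀ {a b} {_ : T (a ≤ᵇ b)} → a ≤ b
≤-closed {a} {b} {a≤ᵇb} = ℕₚ.≤ᵇ⇒≤ a b a≤ᵇb

+-cong-interchange : ∀ a b {c d c′ d′} → c + d ≡ c′ + d′ → (a + c) + (b + d) ≡ (a + c′) + (b + d′)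
+-cong-interchange a b {c} {d} {c′} {d′} eq = begin
  (a + c) + (b + d)    ≡⟨ interchange a c b d ⟩
  (a + b) + (c + d)    ≡⟨ cong (_+_ (a + b)) eq ⟩
  (a + b) + (c′ + d′)  ≡⟨ interchange a b c′ d′ ⟩
  (a + c′) + (b + d′)  ∎
  where open ≡-Reasoning

-- Distances in a symmetric graph

module Distances {V : Set} (_~_ : V → V → Set) (~-sym : ∀ {x y} → x ~ y → y ~ x) where

  _▷_ : ∀ {x y z n} → Walk _~_ x y n → y ~ z → Walk _~_ x z (suc n)
  nil _    ▷ e′ = cons e′ (nil _)
  cons e p ▷ e′ = cons e (p ▷ e′)

  reverse : ∀ {x y n} → Walk _~_ x y n → Walk _~_ y x n
  reverse (nil x)    = nil x
  reverse (cons e p) = reverse p ▷ ~-sym e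

  _++_ : ∀ {x y z m n} → Walk _~_ x y m → Walk _~_ y z n → Walk _~_ x z (m + n)
  nil _    ++ q = q
  cons e p ++ q = cons e (p ++ q)

  connected-via : (t : V) → (∀ x → ∃[ n ] Walk _~_ x t n) → Connected _~_
  connected-via t reach x y = _ , proj₂ (reach x) ++ reverse (proj₂ (reach y))

  Dist-unique : ∀ {x y m n} → Dist _~_ x y m → Dist _~_ x y n → m ≡ n
  Dist-unique (p , m≤) (q , n≤) = ℕₚ.≤-antisym (m≤ _ q) (n≤ _ p)

  Dist-sym : ∀ {x y n} → Dist _~_ x y n → Dist _~_ y x n
  Dist-sym (p , shortest) = reverse p , λ n′ q → shortest n′ (reverse q)

  Lipschitz : (V → ℕ) → Set
  Lipschitz h = ∀ {x y} → x ~ y → h x ≤ suc (h y)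

  Lipschitz⇒≤+length : ∀ {h} → Lipschitz h → ∀ {x y n} → Walk _~_ x y n → h x ≤ h y + n
  Lipschitz⇒≤+length L (nil _) = ℕₚ.m≤m+n _ 0
  Lipschitz⇒≤+length {h} L {y = y} (cons {n = n} e p) = begin
    h _             ≤⟨ L e ⟩
    suc (h _)       ≤⟨ s≤s (Lipschitz⇒≤+length L p) ⟩
    suc (h y + n)   ≡⟨ sym (ℕₚ.+-suc (h y) n) ⟩
    h y + suc n     ∎
    where open ℕₚ.≤-Reasoning

  record DistanceTo (t : V) (h : V → ℕ) : Set where
    field
      at-target : h t ≡ 0
      lipschitz : Lipschitz h
      descent   : ∀ x → x ≡ t ⊎ ∃[ y ] (x ~ y × h x ≡ suc (h y))

    walk : ∀ n x → h x ≡ n → Walk _~_ x t n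
    walk n x hx≡n with descent x
    ... | inj₁ refl = subst (Walk _~_ t t) (trans (sym at-target) hx≡n) (nil t)
    walk zero    x hx≡0 | inj₂ (y , _ , hx≡1+hy) = contradiction (trans (sym hx≡1+hy) hx≡0) λ ()
    walk (suc n) x hx≡n | inj₂ (y , x~y , hx≡1+hy) =
      cons x~y (walk n y (ℕₚ.suc-injective (trans (sym hx≡1+hy) hx≡n)))

    dist : ∀ x → Dist _~_ x t (h x)
    dist x = walk (h x) x refl , λ n p →
      subst (λ d → h x ≤ d + n) at-target (Lipschitz⇒≤+length lipschitz p)

  doublyResolves : ∀ {x y a b p q r s} →
    Dist _~_ a x p → Dist _~_ a y q → Dist _~_ b x r → Dist _~_ b y s →
    p + s ≢ r + q → DoublyResolves _~_ x y a b
  doublyResolves {p = p} {q} {r} {s} ax ay bx by ne =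
    p , q , r , s , ax , ay , bx , by , ne ∘ Equivalence.to (+a-+b≡+c-+d⇔a+d≡c+b p q r s)

  doublyResolves⁻ : ∀ {x y a b p q r s} → DoublyResolves _~_ x y a b →
    Dist _~_ a x p → Dist _~_ a y q → Dist _~_ b x r → Dist _~_ b y s →
    p + s ≢ r + q
  doublyResolves⁻ (p , q , r , s , ax′ , ay′ , bx′ , by′ , ne) ax ay bx by
    with refl ← Dist-unique ax ax′ | refl ← Dist-unique ay ay′
       | refl ← Dist-unique bx bx′ | refl ← Dist-unique by by′ =
    ne ∘ Equivalence.from (+a-+b≡+c-+d⇔a+d≡c+b p q r s)

-- Counting

lookup-injective : ∀ {A : Set} {l : List A} → Unique l → ∀ {s t} → lookup l s ≡ lookup l t → s ≡ t
lookup-injective (_  ∷ _) {zero}  {zero}  _  = refl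
lookup-injective (∉ ∷ _) {zero}  {suc t} eq = contradiction eq (All.lookup ∉ (∈-lookup t))
lookup-injective (∉ ∷ _) {suc s} {zero}  eq = contradiction (sym eq) (All.lookup ∉ (∈-lookup s))
lookup-injective (_  ∷ un) {suc s} {suc t} eq = cong suc (lookup-injective un eq)

Unique⇒length≤ : ∀ {A : Set} {l : List A} {N} → Unique l → (f : ∀ {a} → a ∈ l → Fin N) →
  (∀ {a b} (p : a ∈ l) (q : b ∈ l) → f p ≡ f q → a ≡ b) → length l ≤ N
Unique⇒length≤ un f f-inj = Fin.injective⇒≤ λ {s} {t} eq →
  lookup-injective un (f-inj (∈-lookup s) (∈-lookup t) eq)

funToFin-injective : ∀ {n} {f g : Fin n → Fin 2} → funToFin f ≡ funToFin g → f ≗ g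
funToFin-injective {f = f} {g} eq t = begin
  f t                        ≡⟨ sym (Fin.finToFun-funToFin f t) ⟩
  finToFun (funToFin f) t    ≡⟨ cong (λ c → finToFun c t) eq ⟩
  finToFun (funToFin g) t    ≡⟨ Fin.finToFun-funToFin g t ⟩
  g t                        ∎
  where open ≡-Reasoning

DifferByConstant : ∀ {n} → (Fin n → Fin 2) → (Fin n → Fin 2) → Set
DifferByConstant f g = ∀ t t′ → toℕ (f t) + toℕ (g t′) ≡ toℕ (g t) + toℕ (f t′)

module _ {n : ℕ} where

  -- Two binary vectors differ by a constant iff they are equal or are the
  -- all-zero and all-one vectors; normalise identifies these two.
  normalise : (Fin n → Fin 2) → Fin n → Fin 2
  normalise f with Fin.all? (λ t → f t Fin.≟ zero)
  ... | yes _ = λ _ → suc zero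
  ... | no  _ = f

  normalise-≗⇒DifferByConstant : ∀ f g → normalise f ≗ normalise g → DifferByConstant f g
  normalise-≗⇒DifferByConstant f g eq t t′
    with Fin.all? (λ t → f t Fin.≟ zero) | Fin.all? (λ t → g t Fin.≟ zero)
  ... | yes f≗0 | yes g≗0 rewrite f≗0 t | f≗0 t′ | g≗0 t | g≗0 t′ = refl
  ... | yes f≗0 | no  _   rewrite f≗0 t | f≗0 t′ | sym (eq t) | sym (eq t′) = refl
  ... | no  _   | yes g≗0 rewrite g≗0 t | g≗0 t′ | eq t | eq t′ = refl
  ... | no  _   | no  _   rewrite eq t | eq t′ = refl

  normalise-nonzero : Fin n → ∀ f → ¬ (normalise f ≗ λ _ → zero)
  normalise-nonzero t₀ f with Fin.all? (λ t → f t Fin.≟ zero)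
  ... | yes _  = λ eq → contradiction (eq t₀) λ ()
  ... | no ¬0  = ¬0

¬DifferByConstant⇒k<2^n : ∀ {k n} → 2 ≤ k → (σ : Fin k → Fin n → Fin 2) →
  (∀ {j j′} → j ≢ j′ → ¬ DifferByConstant (σ j) (σ j′)) → k < 2 ^ n
¬DifferByConstant⇒k<2^n {n = zero} (s≤s (s≤s _)) σ separated =
  contradiction (λ ()) (separated {zero} {suc zero} λ ())
¬DifferByConstant⇒k<2^n {k} {suc n} _ σ separated = Fin.injective⇒≤ code-injective
  where
  code : Fin (suc k) → Fin (2 ^ suc n)
  code zero    = funToFin {suc n} (λ _ → zero)
  code (suc j) = funToFin (normalise (σ j))

  code-injective : ∀ {j j′} → code j ≡ code j′ → j ≡ j′
  code-injective {zero}  {zero}   _  = refl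
  code-injective {zero}  {suc j}  eq =
    contradiction (sym ∘ funToFin-injective {g = normalise (σ j)} eq) (normalise-nonzero zero (σ j))
  code-injective {suc j} {zero}   eq =
    contradiction (funToFin-injective {f = normalise (σ j)} eq) (normalise-nonzero zero (σ j))
  code-injective {suc j} {suc j′} eq with j Fin.≟ j′
  ... | yes j≡j′ = cong suc j≡j′
  ... | no  j≢j′ = contradiction
    (normalise-≗⇒DifferByConstant (σ j) (σ j′) (funToFin-injective {f = normalise (σ j)} eq))
    (separated j≢j′)

-- Logarithms and binary digits

n<2^n : ∀ n → n < 2 ^ n
n<2^n zero    = s≤s z≤n
n<2^n (suc n) = ℕₚ.+-mono-≤ (ℕₚ.m^n>0 2 n) (ℕₚ.≤-trans (n<2^n n) (ℕₚ.m≤m+n (2 ^ n) 0))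

≤2^⇒⌈log₂⌉≤ : ∀ {a n} → a ≤ 2 ^ n → ⌈log₂ a ⌉ ≤ n
≤2^⇒⌈log₂⌉≤ {n = n} a≤2ⁿ = subst (_ ≤_) (⌈log₂2^n⌉≡n n) (⌈log₂⌉-mono-≤ a≤2ⁿ)

⌈log₂1+2^n⌉≡1+n : ∀ n → ⌈log₂ (suc (2 ^ n)) ⌉ ≡ suc n
⌈log₂1+2^n⌉≡1+n zero    = refl
⌈log₂1+2^n⌉≡1+n (suc n) = m∸1≡1+n⇒m≡2+n (begin
  ⌈log₂ (suc (2 ^ suc n)) ⌉ ∸ 1   ≡⟨ sym (⌈log₂⌈n/2⌉⌉≡⌈log₂n⌉∸1 (suc (2 ^ suc n))) ⟩
  ⌈log₂ suc ⌊ 2 ^ n + (2 ^ n + 0) /2⌋ ⌉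
    ≡⟨ cong (λ h → ⌈log₂ suc ⌊ 2 ^ n + h /2⌋ ⌉) (ℕₚ.+-identityʳ (2 ^ n)) ⟩
  ⌈log₂ suc ⌊ 2 ^ n + 2 ^ n /2⌋ ⌉ ≡⟨ cong (λ h → ⌈log₂ suc h ⌉) (sym (ℕₚ.n≡⌊n+n/2⌋ (2 ^ n))) ⟩
  ⌈log₂ suc (2 ^ n) ⌉             ≡⟨ ⌈log₂1+2^n⌉≡1+n n ⟩
  suc n                           ∎)
  where
  open ≡-Reasoning
  m∸1≡1+n⇒m≡2+n : ∀ {m n} → m ∸ 1 ≡ suc n → m ≡ suc (suc n)
  m∸1≡1+n⇒m≡2+n {suc m} refl = refl

≤2^⌈log₂⌉ : ∀ a → a ≤ 2 ^ ⌈log₂ a ⌉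
≤2^⌈log₂⌉ a with a ≤? 2 ^ ⌈log₂ a ⌉
... | yes a≤ = a≤
... | no  a≰ = contradiction
  (subst (_≤ ⌈log₂ a ⌉) (⌈log₂1+2^n⌉≡1+n ⌈log₂ a ⌉) (⌈log₂⌉-mono-≤ (ℕₚ.≰⇒> a≰)))
  (ℕₚ.<-irrefl refl)

<⌈log₂⌉⇒2^< : ∀ {a n} → n < ⌈log₂ a ⌉ → 2 ^ n < a
<⌈log₂⌉⇒2^< {a} {n} n<log with 2 ^ n <? a
... | yes 2ⁿ<a = 2ⁿ<a
... | no  2ⁿ≮a = contradiction (≤2^⇒⌈log₂⌉≤ (ℕₚ.≮⇒≥ 2ⁿ≮a)) (ℕₚ.<⇒≱ n<log)

2^≢0 : ∀ t → NonZero (2 ^ t)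
2^≢0 t = ℕₚ.m^n≢0 2 t

bit : ℕ → ℕ → ℕ
bit n t = (n / 2 ^ t) {{2^≢0 t}} % 2

bit≤1 : ∀ n t → bit n t ≤ 1
bit≤1 n t = ℕₚ.≤-pred (m%n<n ((n / 2 ^ t) {{2^≢0 t}}) 2)

bit≡0⊎bit≡1 : ∀ n t → bit n t ≡ 0 ⊎ bit n t ≡ 1
bit≡0⊎bit≡1 n t with bit n t | bit≤1 n t
... | 0 | _ = inj₁ refl
... | 1 | _ = inj₂ refl
... | suc (suc _) | s≤s ()

bit-suc : ∀ n t → bit n (suc t) ≡ bit (n / 2) t
bit-suc n t = cong (_% 2) (sym (m/n/o≡m/[n*o] n 2 (2 ^ t) {{_}} {{2^≢0 t}} {{2^≢0 (suc t)}}))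

bit-< : ∀ {n} t → n < 2 ^ t → bit n t ≡ 0
bit-< t n<2ᵗ = cong (_% 2) (m<n⇒m/n≡0 {{2^≢0 t}} n<2ᵗ)

bit-2^ : ∀ t → bit (2 ^ t) t ≡ 1
bit-2^ t = cong (_% 2) (n/n≡1 (2 ^ t) {{2^≢0 t}})

bits-injective : ∀ {m a b} → a < 2 ^ m → b < 2 ^ m →
  (∀ (i : Fin m) → bit a (toℕ i) ≡ bit b (toℕ i)) → a ≡ b
bits-injective {zero} {0}     {0}     _         _         _ = refl
bits-injective {zero} {suc _} {_}     (s≤s ()) _         _
bits-injective {zero} {_}     {suc _} _         (s≤s ()) _
bits-injective {suc m} {a} {b} a< b< same = begin
  a                   ≡⟨ m≡m%n+[m/n]*n a 2 ⟩
  a % 2 + (a / 2) * 2 ≡⟨ cong₂ (λ r q → r + q * 2) low high ⟩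
  b % 2 + (b / 2) * 2 ≡⟨ sym (m≡m%n+[m/n]*n b 2) ⟩
  b                   ∎
  where
  open ≡-Reasoning
  low : a % 2 ≡ b % 2
  low = trans (cong (_% 2) (sym (n/1≡n a))) (trans (same zero) (cong (_% 2) (n/1≡n b)))
  halve : ∀ {c} → c < 2 ^ suc m → c / 2 < 2 ^ m
  halve {c} c< = m<n*o⇒m/o<n (subst (c <_) (ℕₚ.*-comm 2 (2 ^ m)) c<)
  high : a / 2 ≡ b / 2
  high = bits-injective (halve a<) (halve b<) λ i →
    trans (sym (bit-suc a (toℕ i))) (trans (same (suc i)) (bit-suc b (toℕ i)))

different-bit : ∀ {m a b} → a < 2 ^ m → b < 2 ^ m → a ≢ b →
  ∃[ i ] bit a (toℕ {m} i) ≢ bit b (toℕ i)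
different-bit {m} {a} {b} a< b< a≢b =
  Fin.¬∀⟶∃¬ m _ (λ i → bit a (toℕ i) ℕₚ.≟ bit b (toℕ i)) (a≢b ∘ bits-injective a< b<)

-- The line graph of A_k

module LineGraphA {k : ℕ} (2≤k : 2 ≤ k) where

  m : ℕ
  m = mA k

  vbit : Fin k → Fin m → ℕ
  vbit j i = bit (suc (toℕ j)) (toℕ i)

  vbit≡0⊎vbit≡1 : ∀ j i → vbit j i ≡ 0 ⊎ vbit j i ≡ 1
  vbit≡0⊎vbit≡1 j i = bit≡0⊎bit≡1 (suc (toℕ j)) (toℕ i)

  vbit≢0⇒≡1 : ∀ {j i} → vbit j i ≢ 0 → vbit j i ≡ 1
  vbit≢0⇒≡1 {j} {i} ≢0 with vbit≡0⊎vbit≡1 j i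
  ... | inj₁ ≡0 = contradiction ≡0 ≢0
  ... | inj₂ ≡1 = ≡1

  vbit-fromℕ< : ∀ {a} (a<k : a < k) i → vbit (fromℕ< a<k) i ≡ bit (suc a) (toℕ i)
  vbit-fromℕ< a<k i = cong (λ a → bit (suc a) (toℕ i)) (Fin.toℕ-fromℕ< a<k)

  1+toℕ<2^m : ∀ (j : Fin k) → suc (toℕ j) < 2 ^ m
  1+toℕ<2^m j = ℕₚ.<-≤-trans (s≤s (Fin.toℕ<n j)) (≤2^⌈log₂⌉ (suc k))

  0<k : 0 < k
  0<k = ℕₚ.<-trans (s≤s z≤n) 2≤k

  j₀ : Fin k
  j₀ = fromℕ< 0<k

  zero-bit-at : ∀ i → ∃[ j ] BitZero j i
  zero-bit-at i with toℕ i in eq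
  ... | zero  = fromℕ< 2≤k , trans (vbit-fromℕ< 2≤k i) (cong (bit 2) eq)
  ... | suc t = j₀ , trans (vbit-fromℕ< 0<k i)
                  (trans (cong (bit 1) eq) (bit-< (suc t) (ℕₚ.*-monoʳ-≤ 2 (ℕₚ.m^n>0 2 t))))

  one-zero⇒≢ʲ : ∀ {j j′ i} → vbit j i ≡ 1 → vbit j′ i ≡ 0 → j ≢ j′
  one-zero⇒≢ʲ b≡1 b′≡0 refl = contradiction (trans (sym b≡1) b′≡0) λ ()

  one-zero⇒≢ⁱ : ∀ {j i i′} → vbit j i ≡ 1 → vbit j i′ ≡ 0 → i ≢ i′
  one-zero⇒≢ⁱ b≡1 b′≡0 refl = contradiction (trans (sym b≡1) b′≡0) λ ()

  one-bit-of : ∀ j → ∃[ i ] vbit j i ≡ 1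
  one-bit-of j with different-bit (1+toℕ<2^m j) (ℕₚ.m^n>0 2 m) (λ ())
  ... | i , differs = i , vbit≢0⇒≡1 {j} {i} λ ≡0 → differs (trans ≡0 (sym (bit-< (toℕ i) (ℕₚ.m^n>0 2 (toℕ i)))))

  2≤m : 2 ≤ m
  2≤m = ⌈log₂⌉-mono-≤ (s≤s 2≤k)

  i₀ i₁ : Fin m
  i₀ = fromℕ< (ℕₚ.<-trans (s≤s z≤n) 2≤m)
  i₁ = fromℕ< 2≤m

  i₁≢i₀ : i₁ ≢ i₀
  i₁≢i₀ eq = contradiction
    (trans (sym (Fin.toℕ-fromℕ< 2≤m)) (trans (cong toℕ eq) (Fin.toℕ-fromℕ< _))) λ ()

  another : ∀ (i : Fin m) → ∃[ i′ ] i′ ≢ i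
  another i with i Fin.≟ i₀
  ... | yes refl = i₁ , i₁≢i₀
  ... | no  i≢i₀ = i₀ , i≢i₀ ∘ sym

  _~_ : EA k → EA k → Set
  _~_ = LAk k

  ~-sym : ∀ {e f} → e ~ f → f ~ e
  ~-sym (e≢f , x , x∈e , x∈f) = e≢f ∘ sym , x , x∈f , x∈e

  open Distances _~_ ~-sym public

  data At : VA k → EA k → Set where
    u∈uv   : ∀ j → At u (uv j)
    v∈uv   : ∀ j → At (v j) (uv j)
    v∈vw   : ∀ j i p → At (v j) (vw j i p)
    w∈vw   : ∀ j i p → At (w i) (vw j i p)
    w∈ww′  : ∀ i → At (w i) (ww' i)
    w′∈ww′ : ∀ i → At (w' i) (ww' i)

  at : ∀ {x e} → Incident endsA x e → At x e
  at {e = uv j}     (inj₁ refl) = u∈uv j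
  at {e = uv j}     (inj₂ refl) = v∈uv j
  at {e = vw j i p} (inj₁ refl) = v∈vw j i p
  at {e = vw j i p} (inj₂ refl) = w∈vw j i p
  at {e = ww' i}    (inj₁ refl) = w∈ww′ i
  at {e = ww' i}    (inj₂ refl) = w′∈ww′ i

  vw-irrelevant : ∀ {j : Fin k} {i} (p q : BitZero j i) → vw j i p ≡ vw j i q
  vw-irrelevant p q = cong (vw _ _) (ℕₚ.≡-irrelevant p q)

  uv~uv : ∀ {j j′} → j ≢ j′ → uv j ~ uv j′
  uv~uv j≢j′ = (λ { refl → j≢j′ refl }) , u , inj₁ refl , inj₁ refl

  uv~vw : ∀ {j i p} → uv j ~ vw j i p
  uv~vw {j} = (λ ()) , v j , inj₂ refl , inj₁ refl

  vw~vwᵛ : ∀ {j i i′ p p′} → i ≢ i′ → vw j i p ~ vw j i′ p′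
  vw~vwᵛ {j} i≢i′ = (λ { refl → i≢i′ refl }) , v j , inj₁ refl , inj₁ refl

  vw~vwʷ : ∀ {j j′ i p p′} → j ≢ j′ → vw j i p ~ vw j′ i p′
  vw~vwʷ {i = i} j≢j′ = (λ { refl → j≢j′ refl }) , w i , inj₂ refl , inj₂ refl

  vw~ww′ : ∀ {j i p} → vw j i p ~ ww' i
  vw~ww′ {i = i} = (λ ()) , w i , inj₂ refl , inj₁ refl

  record LocallyLipschitz (h : EA k → ℕ) : Set where
    field
      uv-uv   : ∀ j j′ → h (uv j) ≤ suc (h (uv j′))
      uv-vw   : ∀ j i p → h (uv j) ≤ suc (h (vw j i p))
      vw-uv   : ∀ j i p → h (vw j i p) ≤ suc (h (uv j))
      vw-vwᵛ  : ∀ j i p i′ p′ → h (vw j i p) ≤ suc (h (vw j i′ p′))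
      vw-vwʷ  : ∀ j j′ i p p′ → h (vw j i p) ≤ suc (h (vw j′ i p′))
      vw-ww′  : ∀ j i p → h (vw j i p) ≤ suc (h (ww' i))
      ww′-vw  : ∀ j i p → h (ww' i) ≤ suc (h (vw j i p))

    lipschitz : Lipschitz h
    lipschitz (_ , _ , x∈e , x∈f) = through (at x∈e) (at x∈f)
      where
      through : ∀ {x e f} → At x e → At x f → h e ≤ suc (h f)
      through (u∈uv j)     (u∈uv j′)      = uv-uv j j′
      through (v∈uv j)     (v∈uv _)       = ℕₚ.n≤1+n _
      through (v∈uv j)     (v∈vw _ i p)   = uv-vw j i p
      through (v∈vw j i p) (v∈uv _)       = vw-uv j i p
      through (v∈vw j i p) (v∈vw _ i′ p′) = vw-vwᵛ j i p i′ p′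
      through (w∈vw j i p) (w∈vw j′ _ p′) = vw-vwʷ j j′ i p p′
      through (w∈vw j i p) (w∈ww′ _)      = vw-ww′ j i p
      through (w∈ww′ i)    (w∈vw j _ p)   = ww′-vw j i p
      through (w∈ww′ i)    (w∈ww′ _)      = ℕₚ.n≤1+n _
      through (w′∈ww′ i)   (w′∈ww′ _)     = ℕₚ.n≤1+n _

  mismatch : Fin k → Fin k → ℕ
  mismatch j j′ with j Fin.≟ j′
  ... | yes _ = 0
  ... | no  _ = 1

  mismatch-≡ : ∀ j → mismatch j j ≡ 0
  mismatch-≡ j with j Fin.≟ j
  ... | yes _   = refl
  ... | no  j≢j = contradiction refl j≢j

  mismatch-≢ : ∀ {j j′} → j ≢ j′ → mismatch j j′ ≡ 1
  mismatch-≢ {j} {j′} j≢j′ with j Fin.≟ j′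
  ... | yes j≡j′ = contradiction j≡j′ j≢j′
  ... | no  _    = refl

  mismatch≤1 : ∀ j j′ → mismatch j j′ ≤ 1
  mismatch≤1 j j′ with j Fin.≟ j′
  ... | yes _ = z≤n
  ... | no  _ = ℕₚ.≤-refl

  level : EA k → ℕ
  level (uv _)     = 0
  level (vw _ _ _) = 1
  level (ww' _)    = 2

  -- 0 exactly when some shortest path from u v_j to e runs through v_j.
  offset : Fin k → EA k → ℕ
  offset j (uv j′)     = mismatch j j′
  offset j (vw j′ _ _) = mismatch j j′
  offset j (ww' i)     = vbit j i

  offset≤1 : ∀ j e → offset j e ≤ 1
  offset≤1 j (uv j′)     = mismatch≤1 j j′
  offset≤1 j (vw j′ _ _) = mismatch≤1 j j′
  offset≤1 j (ww' i)     = bit≤1 (suc (toℕ j)) (toℕ i)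

  distanceTo-uv : ∀ j → DistanceTo (uv j) (λ e → level e + offset j e)
  distanceTo-uv j = record
    { at-target = mismatch-≡ j
    ; lipschitz = LocallyLipschitz.lipschitz lip
    ; descent   = descent
    }
    where
    lip : LocallyLipschitz (λ e → level e + offset j e)
    lip = record
      { uv-uv  = λ j₁ _ → ≤1⇒≤suc (mismatch≤1 j j₁)
      ; uv-vw  = λ _ _ _ → ℕₚ.≤-trans (ℕₚ.n≤1+n _) (ℕₚ.n≤1+n _)
      ; vw-uv  = λ _ _ _ → ℕₚ.≤-refl
      ; vw-vwᵛ = λ _ _ _ _ _ → ℕₚ.n≤1+n _
      ; vw-vwʷ = λ j₁ _ _ _ _ → s≤s (≤1⇒≤suc (mismatch≤1 j j₁))
      ; vw-ww′ = λ j₁ _ _ → s≤s (≤1⇒≤suc (mismatch≤1 j j₁))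
      ; ww′-vw = ww′-vw
      }
      where
      ww′-vw : ∀ j₁ i p → 2 + vbit j i ≤ suc (1 + mismatch j j₁)
      ww′-vw j₁ i p with j Fin.≟ j₁
      ... | yes refl = s≤s (s≤s (ℕₚ.≤-reflexive p))
      ... | no  _    = s≤s (s≤s (bit≤1 (suc (toℕ j)) (toℕ i)))
    descent : ∀ e → e ≡ uv j ⊎ ∃[ f ] (e ~ f × level e + offset j e ≡ suc (level f + offset j f))
    descent (uv j′) with j Fin.≟ j′
    ... | yes refl = inj₁ refl
    ... | no  j≢j′ = inj₂ (uv j , uv~uv (j≢j′ ∘ sym) , cong suc (sym (mismatch-≡ j)))
    descent (vw j′ i p) = inj₂ (uv j′ , ~-sym uv~vw , refl)
    descent (ww' i) with vbit≡0⊎vbit≡1 j i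
    ... | inj₁ b≡0 = inj₂ (vw j i b≡0 , ~-sym vw~ww′ , cong (λ b → 2 + b) (trans b≡0 (sym (mismatch-≡ j))))
    ... | inj₂ b≡1 with zero-bit-at i
    ...   | j′ , b′≡0 = inj₂ (vw j′ i b′≡0 , ~-sym vw~ww′ ,
                              cong (λ b → 2 + b) (trans b≡1 (sym (mismatch-≢ (one-zero⇒≢ʲ {i = i} b≡1 b′≡0)))))

  dist-from-uv : ∀ j e → Dist _~_ (uv j) e (level e + offset j e)
  dist-from-uv j e = Dist-sym (DistanceTo.dist (distanceTo-uv j) e)

  connected : Connected _~_
  connected = connected-via (uv j₀) λ e → _ , proj₁ (DistanceTo.dist (distanceTo-uv j₀) e)

  uv-injective : ∀ {j j′} → uv {k} j ≡ uv j′ → j ≡ j′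
  uv-injective refl = refl

  resolving⇒m≤length : ∀ S → IsDoublyResolvingSet _~_ S → m ≤ length S
  resolving⇒m≤length S resolving = ≤2^⇒⌈log₂⌉≤ (¬DifferByConstant⇒k<2^n 2≤k σ separated)
    where
    σ : Fin k → Fin (length S) → Fin 2
    σ j t = fromℕ< (s≤s (offset≤1 j (lookup S t)))

    σ-at : ∀ {e} (e∈S : e ∈ S) j → toℕ (σ j (index e∈S)) ≡ offset j e
    σ-at e∈S j = trans (Fin.toℕ-fromℕ< _) (cong (offset j) (sym (lookup-index e∈S)))

    separated : ∀ {j j′} → j ≢ j′ → ¬ DifferByConstant (σ j) (σ j′)
    separated {j} {j′} j≢j′ constant with resolving (uv j) (uv j′) (j≢j′ ∘ uv-injective)
    ... | x , y , x∈S , y∈S , resolves =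
      doublyResolves⁻ resolves (dist-from-uv j x) (dist-from-uv j y) (dist-from-uv j′ x) (dist-from-uv j′ y)
        (+-cong-interchange (level x) (level y) (begin
          offset j x + offset j′ y                          ≡⟨ sym (cong₂ _+_ (σ-at x∈S j) (σ-at y∈S j′)) ⟩
          toℕ (σ j (index x∈S)) + toℕ (σ j′ (index y∈S))  ≡⟨ constant (index x∈S) (index y∈S) ⟩
          toℕ (σ j′ (index x∈S)) + toℕ (σ j (index y∈S))  ≡⟨ cong₂ _+_ (σ-at x∈S j′) (σ-at y∈S j) ⟩
          offset j′ x + offset j y                          ∎))
      where open ≡-Reasoning

  CommonNeighbour : Fin m → Fin m → Set
  CommonNeighbour i i′ = ∃ λ (j : Fin k) → BitZero j i × BitZero j i′

  commonNeighbour? : ∀ i i′ → Dec (CommonNeighbour i i′)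
  commonNeighbour? i i′ = Fin.any? λ j → (vbit j i ℕₚ.≟ 0) ×-dec (vbit j i′ ℕₚ.≟ 0)

  ¬CommonNeighbour⇒vbit≡1 : ∀ {i i′} → ¬ CommonNeighbour i i′ → ∀ {j} → BitZero j i′ → vbit j i ≡ 1
  ¬CommonNeighbour⇒vbit≡1 {i} {i′} none {j} b′≡0 = vbit≢0⇒≡1 {j} {i} λ b≡0 → none (j , b≡0 , b′≡0)

  -- For i ≢ i′, d(w_i, w_i′) = 2 + 2 * ε i i′ in A_k.  For k ≥ 4 always ε = 0, but
  -- for k ∈ {2, 3} no v_j is adjacent to both w_0 and w_1.
  ε : Fin m → Fin m → ℕ
  ε i i′ with commonNeighbour? i i′
  ... | yes _ = 0
  ... | no  _ = 1

  ε-close : ∀ {i i′} → CommonNeighbour i i′ → ε i i′ ≡ 0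
  ε-close {i} {i′} c with commonNeighbour? i i′
  ... | yes _ = refl
  ... | no ¬c = contradiction c ¬c

  ε-far : ∀ {i i′} → ¬ CommonNeighbour i i′ → ε i i′ ≡ 1
  ε-far {i} {i′} ¬c with commonNeighbour? i i′
  ... | yes c = contradiction c ¬c
  ... | no  _ = refl

  -- The distance to w_i w′_i; see dist-to-ww′.
  δ : Fin m → EA k → ℕ
  δ i (uv j) = 2 + vbit j i
  δ i (vw j i′ _) with i Fin.≟ i′
  ... | yes _ = 1
  ... | no  _ = 2 + vbit j i * suc (ε i i′)
  δ i (ww' i′) with i Fin.≟ i′
  ... | yes _ = 0
  ... | no  _ = 3 + 2 * ε i i′

  module _ (i : Fin m) where

    δ-vw-irrelevant : ∀ j p → δ i (vw j i p) ≡ 1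
    δ-vw-irrelevant _ _ with i Fin.≟ i
    ... | yes _   = refl
    ... | no  i≢i = contradiction refl i≢i

    δ-ww′-≡ : δ i (ww' i) ≡ 0
    δ-ww′-≡ with i Fin.≟ i
    ... | yes _   = refl
    ... | no  i≢i = contradiction refl i≢i

    δ-vw-≢ : ∀ {i′} j p → i ≢ i′ → δ i (vw j i′ p) ≡ 2 + vbit j i * suc (ε i i′)
    δ-vw-≢ {i′} _ _ i≢i′ with i Fin.≟ i′
    ... | yes i≡i′ = contradiction i≡i′ i≢i′
    ... | no  _    = refl

    δ-ww′-≢ : ∀ {i′} → i ≢ i′ → δ i (ww' i′) ≡ 3 + 2 * ε i i′
    δ-ww′-≢ {i′} i≢i′ with i Fin.≟ i′
    ... | yes i≡i′ = contradiction i≡i′ i≢i′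
    ... | no  _    = refl

    δ-locallyLipschitz : LocallyLipschitz (δ i)
    δ-locallyLipschitz = record
      { uv-uv  = λ j _ → s≤s (s≤s (≤1⇒≤suc (bit≤1 (suc (toℕ j)) (toℕ i))))
      ; uv-vw  = uv-vw
      ; vw-uv  = vw-uv
      ; vw-vwᵛ = vw-vwᵛ
      ; vw-vwʷ = vw-vwʷ
      ; vw-ww′ = vw-ww′
      ; ww′-vw = ww′-vw
      }
      where
      uv-vw : ∀ j i′ p → 2 + vbit j i ≤ suc (δ i (vw j i′ p))
      uv-vw j i′ p with i Fin.≟ i′
      ... | yes refl = s≤s (s≤s (ℕₚ.≤-reflexive p))
      ... | no  _    = s≤s (s≤s (≤1⇒≤suc (bit≤1 (suc (toℕ j)) (toℕ i))))

      vw-uv : ∀ j i′ p → δ i (vw j i′ p) ≤ suc (2 + vbit j i)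
      vw-uv j i′ p with i Fin.≟ i′
      ... | yes _ = ≤-closed
      ... | no  _ with vbit j i | vbit≡0⊎vbit≡1 j i | commonNeighbour? i i′
      ...   | _ | inj₁ refl | _     = ≤-closed
      ...   | _ | inj₂ refl | yes _ = ≤-closed
      ...   | _ | inj₂ refl | no  _ = ≤-closed

      vw-vwᵛ : ∀ j i₁ p₁ i₂ p₂ → δ i (vw j i₁ p₁) ≤ suc (δ i (vw j i₂ p₂))
      vw-vwᵛ j i₁ p₁ i₂ p₂ with i Fin.≟ i₁ | i Fin.≟ i₂
      ... | yes _ | _        = s≤s z≤n
      ... | no  _ | yes refl rewrite p₂ = ℕₚ.≤-refl
      ... | no  _ | no  _ with vbit j i | vbit≡0⊎vbit≡1 j i | commonNeighbour? i i₁
      ...   | _ | inj₁ refl | _     = ≤-closed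
      ...   | _ | inj₂ refl | yes _ = ℕₚ.m≤m+n 3 _
      ...   | _ | inj₂ refl | no  _ = ℕₚ.m≤m+n 4 _

      vw-vwʷ : ∀ j j′ i′ p p′ → δ i (vw j i′ p) ≤ suc (δ i (vw j′ i′ p′))
      vw-vwʷ j j′ i′ p p′ with i Fin.≟ i′
      ... | yes _ = ≤-closed
      ... | no  _ with vbit j i | vbit≡0⊎vbit≡1 j i | commonNeighbour? i i′
      ...   | _ | inj₁ refl | _        = s≤s (s≤s z≤n)
      ...   | _ | inj₂ refl | yes _    = ℕₚ.m≤m+n 3 _
      ...   | _ | inj₂ refl | no  none rewrite ¬CommonNeighbour⇒vbit≡1 {i} {i′} none {j′} p′ = ≤-closed

      vw-ww′ : ∀ j i′ p → δ i (vw j i′ p) ≤ suc (δ i (ww' i′))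
      vw-ww′ j i′ p with i Fin.≟ i′
      ... | yes _ = ≤-closed
      ... | no  _ with vbit j i | vbit≡0⊎vbit≡1 j i | commonNeighbour? i i′
      ...   | _ | inj₁ refl | yes _ = ≤-closed
      ...   | _ | inj₁ refl | no  _ = ≤-closed
      ...   | _ | inj₂ refl | yes _ = ≤-closed
      ...   | _ | inj₂ refl | no  _ = ≤-closed

      ww′-vw : ∀ j i′ p → δ i (ww' i′) ≤ suc (δ i (vw j i′ p))
      ww′-vw j i′ p with i Fin.≟ i′
      ... | yes _ = z≤n
      ... | no  _ with commonNeighbour? i i′
      ...   | yes _    = ≤-closed
      ...   | no  none rewrite ¬CommonNeighbour⇒vbit≡1 {i} {i′} none {j} p = ≤-closed

    δ-vw-0 : ∀ {i′} j p → i ≢ i′ → vbit j i ≡ 0 → δ i (vw j i′ p) ≡ 2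
    δ-vw-0 {i′} j p i≢i′ b≡0 = trans (δ-vw-≢ j p i≢i′) (cong (λ b → 2 + b * suc (ε i i′)) b≡0)

    δ-vw-1 : ∀ {i′} j p → i ≢ i′ → vbit j i ≡ 1 → δ i (vw j i′ p) ≡ 3 + ε i i′
    δ-vw-1 {i′} j p i≢i′ b≡1 = begin
      δ i (vw j i′ p)                ≡⟨ δ-vw-≢ j p i≢i′ ⟩
      2 + vbit j i * suc (ε i i′)    ≡⟨ cong (λ b → 2 + b * suc (ε i i′)) b≡1 ⟩
      2 + (suc (ε i i′) + 0)         ≡⟨ cong (λ e → 2 + e) (ℕₚ.+-identityʳ _) ⟩
      3 + ε i i′                     ∎
      where open ≡-Reasoning

    Descends : EA k → Set
    Descends e = ∃[ f ] (e ~ f × δ i e ≡ suc (δ i f))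

    step : ∀ {e n} f → e ~ f → δ i e ≡ suc n → δ i f ≡ n → Descends e
    step f e~f δe≡1+n δf≡n = f , e~f , trans δe≡1+n (cong suc (sym δf≡n))

    uv-descends : ∀ j → Descends (uv j)
    uv-descends j with vbit≡0⊎vbit≡1 j i
    ... | inj₁ b≡0 = step (vw j i b≡0) uv~vw (cong (λ b → 2 + b) b≡0) (δ-vw-irrelevant j b≡0)
    ... | inj₂ b≡1 with zero-bit-at i
    ...   | j′ , b′≡0 = step (uv j′) (uv~uv (one-zero⇒≢ʲ {i = i} b≡1 b′≡0))
                          (cong (λ b → 2 + b) b≡1) (cong (λ b → 2 + b) b′≡0)

    vw-descends : ∀ j i′ p → Dec (i ≡ i′) → Descends (vw j i′ p)
    vw-descends j _ p (yes refl) = step (ww' i) vw~ww′ (δ-vw-irrelevant j p) δ-ww′-≡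
    vw-descends j i′ p (no i≢i′) with vbit≡0⊎vbit≡1 j i
    ... | inj₁ b≡0 = step (vw j i b≡0) (vw~vwᵛ (i≢i′ ∘ sym)) (δ-vw-0 j p i≢i′ b≡0) (δ-vw-irrelevant j b≡0)
    ... | inj₂ b≡1 with commonNeighbour? i i′
    ...   | yes c@(j′ , b′≡0 , b″≡0) =
      step (vw j′ i′ b″≡0) (vw~vwʷ (one-zero⇒≢ʲ {i = i} b≡1 b′≡0))
        (trans (δ-vw-1 j p i≢i′ b≡1) (cong (λ e → 3 + e) (ε-close {i} {i′} c)))
        (δ-vw-0 j′ b″≡0 i≢i′ b′≡0)
    ...   | no  ¬c =
      step (uv j) (~-sym uv~vw)
        (trans (δ-vw-1 j p i≢i′ b≡1) (cong (λ e → 3 + e) (ε-far {i} {i′} ¬c)))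
        (cong (λ b → 2 + b) b≡1)

    ww′-descends : ∀ {i′} → i ≢ i′ → Descends (ww' i′)
    ww′-descends {i′} i≢i′ with commonNeighbour? i i′
    ... | yes c@(j , b≡0 , b′≡0) =
      step (vw j i′ b′≡0) (~-sym vw~ww′)
        (trans (δ-ww′-≢ i≢i′) (cong (λ e → 3 + 2 * e) (ε-close {i} {i′} c)))
        (δ-vw-0 j b′≡0 i≢i′ b≡0)
    ... | no  ¬c with zero-bit-at i′
    ...   | j , b′≡0 =
      step (vw j i′ b′≡0) (~-sym vw~ww′)
        (trans (δ-ww′-≢ i≢i′) (cong (λ e → 3 + 2 * e) (ε-far {i} {i′} ¬c)))
        (trans (δ-vw-1 j b′≡0 i≢i′ (¬CommonNeighbour⇒vbit≡1 {i} {i′} ¬c {j} b′≡0))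
               (cong (λ e → 3 + e) (ε-far {i} {i′} ¬c)))

    δ-descent : ∀ e → e ≡ ww' i ⊎ Descends e
    δ-descent (uv j)      = inj₂ (uv-descends j)
    δ-descent (vw j i′ p) = inj₂ (vw-descends j i′ p (i Fin.≟ i′))
    δ-descent (ww' i′)    = ww′-case (i Fin.≟ i′)
      where
      ww′-case : Dec (i ≡ i′) → ww' i′ ≡ ww' i ⊎ Descends (ww' i′)
      ww′-case (yes refl) = inj₁ refl
      ww′-case (no i≢i′)  = inj₂ (ww′-descends i≢i′)

    distanceTo-ww′ : DistanceTo (ww' i) (δ i)
    distanceTo-ww′ = record
      { at-target = δ-ww′-≡
      ; lipschitz = LocallyLipschitz.lipschitz δ-locallyLipschitz
      ; descent   = δ-descent
      }

    dist-to-ww′ : ∀ e → Dist _~_ e (ww' i) (δ i e)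
    dist-to-ww′ = DistanceTo.dist distanceTo-ww′

    δ-uv≤3 : ∀ j → δ i (uv j) ≤ 3
    δ-uv≤3 j = s≤s (s≤s (bit≤1 (suc (toℕ j)) (toℕ i)))

    2≤δ-vw : ∀ {i′} j p → i ≢ i′ → 2 ≤ δ i (vw j i′ p)
    2≤δ-vw j p i≢i′ = subst (2 ≤_) (sym (δ-vw-≢ j p i≢i′)) (ℕₚ.m≤m+n 2 _)

    3≤δ-vw : ∀ {i′} j p → i ≢ i′ → vbit j i ≡ 1 → 3 ≤ δ i (vw j i′ p)
    3≤δ-vw j p i≢i′ b≡1 = subst (3 ≤_) (sym (δ-vw-1 j p i≢i′ b≡1)) (ℕₚ.m≤m+n 3 _)

    3≤δ-ww′ : ∀ {i′} → i ≢ i′ → 3 ≤ δ i (ww' i′)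
    3≤δ-ww′ i≢i′ = subst (3 ≤_) (sym (δ-ww′-≢ i≢i′)) (ℕₚ.m≤m+n 3 _)

    δ-vw≤δ-ww′ : ∀ {i′} j p → i ≢ i′ → δ i (vw j i′ p) ≤ δ i (ww' i′)
    δ-vw≤δ-ww′ {i′} j p i≢i′ with vbit≡0⊎vbit≡1 j i
    ... | inj₁ b≡0 = subst (_≤ δ i (ww' i′)) (sym (δ-vw-0 j p i≢i′ b≡0)) (ℕₚ.≤-trans (ℕₚ.n≤1+n 2) (3≤δ-ww′ i≢i′))
    ... | inj₂ b≡1 = begin
      δ i (vw j i′ p)   ≡⟨ δ-vw-1 j p i≢i′ b≡1 ⟩
      3 + ε i i′        ≤⟨ ℕₚ.+-monoʳ-≤ 3 (ℕₚ.m≤m+n (ε i i′) _) ⟩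
      3 + 2 * ε i i′    ≡⟨ sym (δ-ww′-≢ i≢i′) ⟩
      δ i (ww' i′)      ∎
      where open ℕₚ.≤-Reasoning

  Separates : EA k → EA k → Set
  Separates a b = ∃[ i ] ∃[ i′ ] (δ i a < δ i b × δ i′ b ≤ δ i′ a)

  splitting-bit : ∀ {j j′} → j ≢ j′ →
    (∃[ i ] (vbit j i ≡ 0 × vbit j′ i ≡ 1)) ⊎ (∃[ i ] (vbit j′ i ≡ 0 × vbit j i ≡ 1))
  splitting-bit {j} {j′} j≢j′ with different-bit (1+toℕ<2^m j) (1+toℕ<2^m j′) (j≢j′ ∘ Fin.toℕ-injective ∘ ℕₚ.suc-injective)
  ... | i , differ with vbit≡0⊎vbit≡1 j i | vbit≡0⊎vbit≡1 j′ i
  ...   | inj₁ b≡0 | inj₁ b′≡0 = contradiction (trans b≡0 (sym b′≡0)) differ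
  ...   | inj₁ b≡0 | inj₂ b′≡1 = inj₁ (i , b≡0 , b′≡1)
  ...   | inj₂ b≡1 | inj₁ b′≡0 = inj₂ (i , b′≡0 , b≡1)
  ...   | inj₂ b≡1 | inj₂ b′≡1 = contradiction (trans b≡1 (sym b′≡1)) differ

  uv-separates : ∀ {j j′} → ∃[ i ] (vbit j i ≡ 0 × vbit j′ i ≡ 1) → Separates (uv j) (uv j′)
  uv-separates {j} {j′} (i , b≡0 , b′≡1) with one-bit-of j
  ... | i′ , b≡1 = i , i′ ,
    subst₂ (λ b b′ → 2 + b < 2 + b′) (sym b≡0) (sym b′≡1) ≤-closed ,
    subst (λ b → δ i′ (uv j′) ≤ 2 + b) (sym b≡1) (δ-uv≤3 i′ j′)

  vw-separates-uv : ∀ j j′ i′ p → Separates (vw j′ i′ p) (uv j)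
  vw-separates-uv j j′ i′ p with one-bit-of j′
  ... | i , b′≡1 = i′ , i ,
    subst (_< δ i′ (uv j)) (sym (δ-vw-irrelevant i′ j′ p)) (s≤s (s≤s z≤n)) ,
    ℕₚ.≤-trans (δ-uv≤3 i j) (3≤δ-vw i j′ p (one-zero⇒≢ⁱ b′≡1 p) b′≡1)

  ww′-separates-uv : ∀ j i′ → Separates (ww' i′) (uv j)
  ww′-separates-uv j i′ with another i′
  ... | i , i≢i′ = i′ , i ,
    subst (_< δ i′ (uv j)) (sym (δ-ww′-≡ i′)) (s≤s z≤n) ,
    ℕₚ.≤-trans (δ-uv≤3 i j) (3≤δ-ww′ i i≢i′)

  vw-separates-vw : ∀ j j′ {i₁ i₂} p₁ p₂ → i₁ ≢ i₂ → Separates (vw j i₁ p₁) (vw j′ i₂ p₂)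
  vw-separates-vw j j′ {i₁} {i₂} p₁ p₂ i₁≢i₂ = i₁ , i₂ ,
    subst (_< δ i₁ (vw j′ i₂ p₂)) (sym (δ-vw-irrelevant i₁ j p₁)) (2≤δ-vw i₁ j′ p₂ i₁≢i₂) ,
    subst (_≤ δ i₂ (vw j i₁ p₁)) (sym (δ-vw-irrelevant i₂ j′ p₂)) (ℕₚ.≤-trans (ℕₚ.n≤1+n 1) (2≤δ-vw i₂ j p₁ (i₁≢i₂ ∘ sym)))

  vw-separates-vwʷ : ∀ {j j′ i′} p p′ → ∃[ i ] (vbit j i ≡ 0 × vbit j′ i ≡ 1) →
    Separates (vw j i′ p) (vw j′ i′ p′)
  vw-separates-vwʷ {j} {j′} {i′} p p′ (i , b≡0 , b′≡1) = i , i′ ,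
    subst (_< δ i (vw j′ i′ p′)) (sym (δ-vw-0 i j p i≢i′ b≡0)) (3≤δ-vw i j′ p′ i≢i′ b′≡1) ,
    ℕₚ.≤-reflexive (trans (δ-vw-irrelevant i′ j′ p′) (sym (δ-vw-irrelevant i′ j p)))
    where i≢i′ = one-zero⇒≢ⁱ b′≡1 p′

  ww′-separates-vw : ∀ j i′ p → Separates (ww' i′) (vw j i′ p)
  ww′-separates-vw j i′ p with another i′
  ... | i , i≢i′ = i′ , i ,
    subst₂ _<_ (sym (δ-ww′-≡ i′)) (sym (δ-vw-irrelevant i′ j p)) ≤-closed ,
    δ-vw≤δ-ww′ i j p i≢i′

  vw-separates-ww′ : ∀ j {i₁ i₂} p → i₁ ≢ i₂ → Separates (vw j i₁ p) (ww' i₂)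
  vw-separates-ww′ j {i₁} {i₂} p i₁≢i₂ = i₁ , i₂ ,
    subst (_< δ i₁ (ww' i₂)) (sym (δ-vw-irrelevant i₁ j p)) (ℕₚ.≤-trans ≤-closed (3≤δ-ww′ i₁ i₁≢i₂)) ,
    subst (_≤ δ i₂ (vw j i₁ p)) (sym (δ-ww′-≡ i₂)) z≤n

  ww′-separates-ww′ : ∀ {i₁ i₂} → i₁ ≢ i₂ → Separates (ww' i₁) (ww' i₂)
  ww′-separates-ww′ {i₁} {i₂} i₁≢i₂ = i₁ , i₂ ,
    subst (_< δ i₁ (ww' i₂)) (sym (δ-ww′-≡ i₁)) (ℕₚ.≤-trans ≤-closed (3≤δ-ww′ i₁ i₁≢i₂)) ,
    subst (_≤ δ i₂ (ww' i₁)) (sym (δ-ww′-≡ i₂)) z≤n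

  separates : ∀ a b → a ≢ b → Separates a b ⊎ Separates b a
  separates (uv j)      (uv j′)       uv≢uv = Sum.map uv-separates uv-separates (splitting-bit (uv≢uv ∘ cong uv))
  separates (uv j)      (vw j′ i′ p)  _     = inj₂ (vw-separates-uv j j′ i′ p)
  separates (uv j)      (ww' i′)      _     = inj₂ (ww′-separates-uv j i′)
  separates (vw j i₁ p) (vw j′ i₂ p′) vw≢vw with i₁ Fin.≟ i₂
  ... | no  i₁≢i₂ = inj₁ (vw-separates-vw j j′ p p′ i₁≢i₂)
  ... | yes refl  = Sum.map (vw-separates-vwʷ p p′) (vw-separates-vwʷ p′ p) (splitting-bit j≢j′)
    where
    j≢j′ : j ≢ j′
    j≢j′ refl = vw≢vw (vw-irrelevant p p′)
  separates (vw j i₁ p) (ww' i₂)      _ with i₁ Fin.≟ i₂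
  ... | yes refl  = inj₂ (ww′-separates-vw j i₁ p)
  ... | no  i₁≢i₂ = inj₁ (vw-separates-ww′ j p i₁≢i₂)
  separates (ww' i₁)    (ww' i₂)      ww≢ww = inj₁ (ww′-separates-ww′ (ww≢ww ∘ cong ww'))
  separates a@(vw _ _ _) b@(uv _)     a≢b   = Sum.swap (separates b a (a≢b ∘ sym))
  separates a@(ww' _)    b@(uv _)     a≢b   = Sum.swap (separates b a (a≢b ∘ sym))
  separates a@(ww' _)    b@(vw _ _ _) a≢b   = Sum.swap (separates b a (a≢b ∘ sym))

  ww′-injective : ∀ {i i′} → ww' {k} i ≡ ww' i′ → i ≡ i′
  ww′-injective refl = refl

  W : List (EA k)
  W = map ww' (allFin m)

  W-unique : Unique W
  W-unique = map⁺ ww′-injective (allFin⁺ m)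

  length-W : length W ≡ m
  length-W = trans (LP.length-map (ww' {k}) (allFin m)) (LP.length-tabulate {n = m} id)

  resolved-in-W : ∀ {a b} i i′ → δ i a + δ i′ b ≢ δ i b + δ i′ a →
    ∃[ x ] ∃[ y ] (x ∈ W × y ∈ W × DoublyResolves _~_ x y a b)
  resolved-in-W {a} {b} i i′ ne = ww' i , ww' i′ , ∈W i , ∈W i′ ,
    doublyResolves (dist-to-ww′ i a) (dist-to-ww′ i′ a) (dist-to-ww′ i b) (dist-to-ww′ i′ b) ne
    where ∈W = λ i → ∈-map⁺ ww' (∈-allFin i)

  W-resolving : IsDoublyResolvingSet _~_ W
  W-resolving a b a≢b with separates a b a≢b
  ... | inj₁ (i , i′ , lt , le) = resolved-in-W i i′ (ℕₚ.<⇒≢ (ℕₚ.+-mono-<-≤ lt le))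
  ... | inj₂ (i , i′ , lt , le) = resolved-in-W i i′ (ℕₚ.<⇒≢ (ℕₚ.+-mono-<-≤ lt le) ∘ sym)

  m≤k : m ≤ k
  m≤k = ≤2^⇒⌈log₂⌉≤ (n<2^n k)

  one-bit-at : ∀ i → ∃[ j ] vbit j i ≡ 1
  one-bit-at i = fromℕ< a<k , (begin
    vbit (fromℕ< a<k) i    ≡⟨ vbit-fromℕ< a<k i ⟩
    bit (suc a) (toℕ i)    ≡⟨ cong (λ n → bit n (toℕ i)) 1+a≡2ⁱ ⟩
    bit (2 ^ toℕ i) (toℕ i) ≡⟨ bit-2^ (toℕ i) ⟩
    1                      ∎)
    where
    open ≡-Reasoning
    a = pred (2 ^ toℕ i)
    1+a≡2ⁱ : suc a ≡ 2 ^ toℕ i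
    1+a≡2ⁱ = ℕₚ.suc-pred (2 ^ toℕ i) {{2^≢0 (toℕ i)}}
    a<k : a < k
    a<k = subst (_≤ k) (sym 1+a≡2ⁱ) (ℕₚ.≤-pred (<⌈log₂⌉⇒2^< (Fin.toℕ<n i)))

  label : ∀ {x e} → At x e → Fin k
  label (u∈uv j)     = j
  label (v∈uv j)     = inject≤ (proj₁ (one-bit-of j)) m≤k
  label (v∈vw _ i _) = inject≤ i m≤k
  label (w∈vw j _ _) = j
  label (w∈ww′ i)    = proj₁ (one-bit-at i)
  label (w′∈ww′ _)   = j₀

  label-injective : ∀ {x e f} (x∈e : At x e) (x∈f : At x f) → label x∈e ≡ label x∈f → e ≡ f
  label-injective (u∈uv _)     (u∈uv _)     eq = cong uv eq
  label-injective (v∈uv _)     (v∈uv _)     _  = refl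
  label-injective (v∈uv j)     (v∈vw _ i p) eq =
    contradiction (trans (sym (proj₂ (one-bit-of j))) (trans (cong (vbit j) (Fin.inject≤-injective _ _ _ _ eq)) p)) λ ()
  label-injective (v∈vw j i p) (v∈uv _)     eq =
    contradiction (trans (sym (proj₂ (one-bit-of j))) (trans (cong (vbit j) (Fin.inject≤-injective _ _ _ _ (sym eq))) p)) λ ()
  label-injective (v∈vw _ _ p) (v∈vw _ _ q) eq with refl ← Fin.inject≤-injective _ _ _ _ eq = vw-irrelevant p q
  label-injective (w∈vw _ _ p) (w∈vw _ _ q) refl = vw-irrelevant p q
  label-injective (w∈vw j i p) (w∈ww′ _)    refl = contradiction (trans (sym (proj₂ (one-bit-at i))) p) λ ()
  label-injective (w∈ww′ i)    (w∈vw j _ p) refl = contradiction (trans (sym (proj₂ (one-bit-at i))) p) λ ()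
  label-injective (w∈ww′ _)    (w∈ww′ _)    _  = refl
  label-injective (w′∈ww′ _)   (w′∈ww′ _)   _  = refl

  degree≤k : ∀ (x : VA k) d → DegreeIs endsA x d → d ≤ k
  degree≤k x _ (l , unique , ∈l⇔incident , refl) =
    Unique⇒length≤ unique (label ∘ incidence) λ p q eq → label-injective (incidence p) (incidence q) eq
    where
    incidence : ∀ {e} → e ∈ l → At x e
    incidence {e} = at ∘ Equivalence.to (∈l⇔incident e)

  degree-u≡k : DegreeIs (endsA {k}) u k
  degree-u≡k = map uv (allFin k) , map⁺ uv-injective (allFin⁺ k) , (λ e → mk⇔ (to e) (from e)) ,
             trans (LP.length-map uv (allFin k)) (LP.length-tabulate id)
    where
    to : ∀ e → e ∈ map uv (allFin k) → Incident endsA u e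
    to e e∈ with ∈-map⁻ uv e∈
    ... | j , _ , refl = inj₁ refl
    from : ∀ e → Incident endsA u e → e ∈ map uv (allFin k)
    from e u∈e with at {e = e} u∈e
    ... | u∈uv j = ∈-map⁺ uv (∈-allFin j)

  maxDegree≡k : MaxDegreeIs (endsA {k}) k
  maxDegree≡k = (u , degree-u≡k) , degree≤k

proposition1 : (k : ℕ) → 2 ≤ k →
    Connected (LAk k) ×
    PsiIs (LAk k) (mA k) ×
    (∃[ Δ ] (MaxDegreeIs (endsA {k}) Δ × mA k ≡ ⌈log₂ (1 + Δ) ⌉))
proposition1 k 2≤k =
  connected , ((W , W-unique , length-W , W-resolving) , λ S _ → resolving⇒m≤length S) , (k , maxDegree≡k , refl)
  where open LineGraphA 2≤k
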